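{- Let $b\ge 2$ be an integer, let $a_ta_{t-1}\cdots a_0$ be the ordinary base $b$ expansion of a positive integer $n$, and let $c_\ell c_{\ell-1}\cdots c_0$ be a base $b$ over-expansion of $n$. Set $c_i=0$ for all integers $i$ with $\ell<i\leq t$. Then for every $m\in\{0,1,\ldots,t\}$, \[c_m\in\begin{cases}\{0,b-1,b\}, & \text{if } a_m=0;\\ \{0,1,b\}, & \text{if } a_m=1;\\ \{a_m-1,a_m\}, & \text{otherwise}.\end{cases}\]
   Context: A base $b$ over-expansion of a positive integer $N$ is a word $d_kd_{k-1}\cdots d_0$ over the alphabet $\{0,1,\ldots,b\}$ with $d_k\neq 0$ and $\sum_{i=0}^k d_ib^i=N$; $d_i$ is its $i$-th digit. The ordinary base $b$ expansion is the unique such expansion using only digits in $\{0,\ldots,b-1\}$. -}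

module Defs where

open import Data.Nat using (ℕ; zero; suc; _+_; _*_; _∸_; _≤_; _<_)
open import Data.List using (List; []; _∷_; length)
open import Data.List.Relation.Unary.All using (All)
open import Data.Product using (_×_)
open import Data.Sum using (_⊎_)
open import Relation.Binary.PropositionalEquality using (_≡_)
open import Relation.Nullary using (¬_)

-- A word d_k ... d_0 is represented as the list (d_0 ∷ d_1 ∷ ... ∷ d_k ∷ []),
-- i.e. least significant digit first.

value : ℕ → List ℕ → ℕ
value b []       = 0
value b (d ∷ ds) = d + b * value b ds

data LeadingNonzero : List ℕ → Set where
  single : ∀ {d} → ¬ d ≡ 0 → LeadingNonzero (d ∷ [])
  cons   : ∀ {d e ds} → LeadingNonzero (e ∷ ds) → LeadingNonzero (d ∷ e ∷ ds)

digit : List ℕ → ℕ → ℕ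
digit []       i       = 0
digit (d ∷ ds) zero    = d
digit (d ∷ ds) (suc i) = digit ds i

IsOverExpansion : ℕ → ℕ → List ℕ → Set
IsOverExpansion b N ds = All (λ d → d ≤ b) ds × LeadingNonzero ds × value b ds ≡ N

IsOrdinaryExpansion : ℕ → ℕ → List ℕ → Set
IsOrdinaryExpansion b N ds = All (λ d → d < b) ds × LeadingNonzero ds × value b ds ≡ N

Allowed : ℕ → ℕ → ℕ → Set
Allowed b zero          c = c ≡ 0 ⊎ c ≡ b ∸ 1 ⊎ c ≡ b
Allowed b (suc zero)    c = c ≡ 0 ⊎ c ≡ 1 ⊎ c ≡ b
Allowed b (suc (suc a)) c = c ≡ suc a ⊎ c ≡ suc (suc a)

-- Compare the two expansions digit by digit from the bottom, as in a
-- subtraction with borrows.  If the lower parts of c plus a borrow e ∈ {0,1}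
-- agree with those of a, then at the current position either a₀ = c₀ + e
-- with no new borrow, or a₀ + b = c₀ + e with a new borrow of 1: anything
-- larger is impossible because a₀ < b and c₀ + e ≤ b + 1 < 2b.  Each of
-- these two equations leaves only the listed possibilities for c₀.
module Submission where

open import Defs
open import Data.Nat using (ℕ; _≤_; _<_; zero; suc; _+_; _*_; _∸_; z≤n; s≤s; compare; less; equal; greater)
open import Data.Nat.Properties
open import Data.List using (List; length; []; _∷_)
open import Data.List.Relation.Unary.All using (All; []; _∷_)
open import Data.Product using (_×_; _,_)
open import Data.Sum using (_⊎_; inj₁; inj₂)
open import Data.Empty using (⊥-elim)
open import Relation.Binary.PropositionalEquality
open import Data.Nat.Tactic.RingSolver using (solve-∀)

lowDigit : List ℕ → ℕ
lowDigit []      = 0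
lowDigit (d ∷ _) = d

highDigits : List ℕ → List ℕ
highDigits []       = []
highDigits (_ ∷ ds) = ds

value-lowDigit-highDigits : ∀ b ds → value b ds ≡ lowDigit ds + b * value b (highDigits ds)
value-lowDigit-highDigits b []       = sym (*-zeroʳ b)
value-lowDigit-highDigits b (_ ∷ _)  = refl

digit-zero : ∀ ds → digit ds 0 ≡ lowDigit ds
digit-zero []      = refl
digit-zero (_ ∷ _) = refl

digit-suc : ∀ ds m → digit ds (suc m) ≡ digit (highDigits ds) m
digit-suc []      m = refl
digit-suc (_ ∷ _) m = refl

All-lowDigit : ∀ {P : ℕ → Set} → P 0 → ∀ {ds} → All P ds → P (lowDigit ds)
All-lowDigit p0 []      = p0
All-lowDigit p0 (p ∷ _) = p

All-highDigits : ∀ {P : ℕ → Set} {ds} → All P ds → All P (highDigits ds)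
All-highDigits []       = []
All-highDigits (_ ∷ ps) = ps

private
  shift-less : ∀ s b A k → s + b * suc (A + k) ≡ (s + b + b * k) + b * A
  shift-less = solve-∀

  shift-equal : ∀ a₀ b C → (a₀ + b) + b * C ≡ a₀ + b * suc (C + 0)
  shift-equal = solve-∀

  shift-greater : ∀ a₀ b C k → (a₀ + b + b * k) + b * C ≡ a₀ + b * suc (C + k)
  shift-greater = solve-∀

  move-borrow : ∀ e c₀ b C → e + (c₀ + b * C) ≡ (c₀ + e) + b * C
  move-borrow = solve-∀

split-lowDigit : ∀ {b a₀ s A C} → 2 ≤ b → a₀ < b → s ≤ b + 1 →
  a₀ + b * A ≡ s + b * C →
  (a₀ ≡ s × A ≡ C) ⊎ (a₀ + b ≡ s × A ≡ suc C)
split-lowDigit {b} {a₀} {s} {A} {C} 2≤b a₀<b s≤b+1 eq with compare A C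
... | equal .A = inj₁ (+-cancelʳ-≡ (b * A) a₀ s eq , refl)
... | less .A k = ⊥-elim (<⇒≱ a₀<b b≤a₀)
  where
  a₀≡ : a₀ ≡ s + b + b * k
  a₀≡ = +-cancelʳ-≡ (b * A) a₀ _ (trans eq (shift-less s b A k))
  b≤a₀ : b ≤ a₀
  b≤a₀ = subst (b ≤_) (sym a₀≡) (≤-trans (m≤n+m b s) (m≤m+n (s + b) (b * k)))
... | greater .C zero =
  inj₂ (+-cancelʳ-≡ (b * C) (a₀ + b) s (trans (shift-equal a₀ b C) eq) , cong suc (+-identityʳ C))
... | greater .C (suc k) = ⊥-elim (<⇒≱ 2≤b (+-cancelˡ-≤ b b 1 (≤-trans b+b≤s s≤b+1)))
  where
  s≡ : a₀ + b + b * suc k ≡ s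
  s≡ = +-cancelʳ-≡ (b * C) _ s (trans (shift-greater a₀ b C (suc k)) eq)
  b+b≤s : b + b ≤ s
  b+b≤s = subst (b + b ≤_) s≡ (+-mono-≤ (m≤n+m b a₀) (m≤m*n b (suc k)))

allowed-noBorrow : ∀ {b a₀ c₀ e} → e ≤ 1 → a₀ ≡ c₀ + e → Allowed b a₀ c₀
allowed-noBorrow {a₀ = zero}  {c₀} _ eq = inj₁ (m+n≡0⇒m≡0 c₀ (sym eq))
allowed-noBorrow {a₀ = suc zero} {zero}     _ _  = inj₁ refl
allowed-noBorrow {a₀ = suc zero} {suc zero} _ _  = inj₂ (inj₁ refl)
allowed-noBorrow {a₀ = suc zero} {suc (suc c₀)} _ eq = ⊥-elim (0≢1+n (suc-injective eq))
allowed-noBorrow {a₀ = suc (suc a)} {c₀} z≤n eq = inj₂ (sym (trans eq (+-identityʳ c₀)))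
allowed-noBorrow {a₀ = suc (suc a)} {c₀} (s≤s z≤n) eq = inj₁ (sym (suc-injective (trans eq (+-comm c₀ 1))))

allowed-borrow : ∀ {b a₀ c₀ e} → c₀ ≤ b → e ≤ 1 → a₀ + b ≡ c₀ + e → Allowed b a₀ c₀
allowed-borrow {a₀ = zero} {c₀} _ z≤n eq = inj₂ (inj₂ (sym (trans eq (+-identityʳ c₀))))
allowed-borrow {a₀ = zero} {c₀} _ (s≤s z≤n) eq = inj₂ (inj₁ (sym (cong (_∸ 1) (trans eq (+-comm c₀ 1)))))
allowed-borrow {b} {suc zero} {c₀} c₀≤b z≤n eq =
  ⊥-elim (<⇒≱ (subst (b <_) (trans eq (+-identityʳ c₀)) ≤-refl) c₀≤b)
allowed-borrow {b} {suc zero} {c₀} _ (s≤s z≤n) eq = inj₂ (inj₂ (+-cancelʳ-≡ 1 c₀ b (sym (trans (+-comm b 1) eq))))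
allowed-borrow {b} {suc (suc a)} c₀≤b e≤1 eq =
  ⊥-elim (<⇒≱ (s≤s (s≤s z≤n)) (+-cancelˡ-≤ b (suc (suc a)) 1 b+a₀≤b+1))
  where
  b+a₀≤b+1 : b + suc (suc a) ≤ b + 1
  b+a₀≤b+1 = subst (_≤ b + 1) (trans (sym eq) (+-comm (suc (suc a)) b)) (+-mono-≤ c₀≤b e≤1)

allowed-digit : ∀ {b a c e} → 2 ≤ b → All (_< b) a → All (_≤ b) c → e ≤ 1 →
  value b a ≡ e + value b c → ∀ m → Allowed b (digit a m) (digit c m)
allowed-digit {b} {a} {c} {e} 2≤b a<b c≤b e≤1 eq m
  with split-lowDigit 2≤b a₀<b (+-mono-≤ c₀≤b e≤1) lowEq
  where
  a₀<b : lowDigit a < b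
  a₀<b = All-lowDigit (≤-trans (s≤s z≤n) 2≤b) a<b
  c₀≤b : lowDigit c ≤ b
  c₀≤b = All-lowDigit z≤n c≤b
  lowEq : lowDigit a + b * value b (highDigits a) ≡ (lowDigit c + e) + b * value b (highDigits c)
  lowEq = begin
    lowDigit a + b * value b (highDigits a) ≡⟨ sym (value-lowDigit-highDigits b a) ⟩
    value b a                                ≡⟨ eq ⟩
    e + value b c                            ≡⟨ cong (e +_) (value-lowDigit-highDigits b c) ⟩
    e + (lowDigit c + b * value b (highDigits c)) ≡⟨ move-borrow e (lowDigit c) b (value b (highDigits c)) ⟩
    (lowDigit c + e) + b * value b (highDigits c) ∎
    where open ≡-Reasoning
allowed-digit {a = a} {c} _ _ c≤b e≤1 _ zero | inj₁ (a₀≡ , _)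
  rewrite digit-zero a | digit-zero c = allowed-noBorrow e≤1 a₀≡
allowed-digit {a = a} {c} _ _ c≤b e≤1 _ zero | inj₂ (a₀+b≡ , _)
  rewrite digit-zero a | digit-zero c = allowed-borrow (All-lowDigit z≤n c≤b) e≤1 a₀+b≡
allowed-digit {a = a} {c} 2≤b a<b c≤b _ _ (suc m) | inj₁ (_ , A≡C)
  rewrite digit-suc a m | digit-suc c m =
    allowed-digit 2≤b (All-highDigits a<b) (All-highDigits c≤b) z≤n A≡C m
allowed-digit {a = a} {c} 2≤b a<b c≤b _ _ (suc m) | inj₂ (_ , A≡1+C)
  rewrite digit-suc a m | digit-suc c m =
    allowed-digit 2≤b (All-highDigits a<b) (All-highDigits c≤b) ≤-refl A≡1+C m

-- The conclusion holds at every position m.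
lemma9 : (b : ℕ) → 2 ≤ b → (n : ℕ) → 1 ≤ n →
    (a : List ℕ) → IsOrdinaryExpansion b n a →
    (c : List ℕ) → IsOverExpansion b n c →
    (m : ℕ) → m < length a →
    Allowed b (digit a m) (digit c m)
lemma9 b 2≤b _ _ a (a<b , _ , a≡n) c (c≤b , _ , c≡n) m _ =
  allowed-digit 2≤b a<b c≤b z≤n (trans a≡n (sym c≡n)) m
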